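{- Let $N$ be a finite set of labelled clauses and let $N^-$ be the subset of $N$ obtained by removing all labelled clauses whose label $(b,k,l)$ satisfies either ($b = 0$ and $k \neq *$) or $l \neq 0$. Then $N^-$ is satisfiable if and only if $N$ is satisfiable.
   Context: $\Sigma$ is a finite set of propositional variables. For each $i \in \mathbb{N}$ let $\Sigma^{(i)} = \{p^{(i)} : p \in \Sigma\}$ be pairwise disjoint copies of $\Sigma$ (with $p^{(0)} = p$), and $\Sigma^* = \bigcup_{i} \Sigma^{(i)}$. A standard clause is a finite set (disjunction) of literals over $\Sigma^*$. For a standard clause $C$ and $t \in \mathbb{N}$, $C^{(t)}$ is obtained by replacing every variable $q^{(i)}$ in $C$ by $q^{(i+t)}$. A label is a triple $(b,k,l) \in \{*,0\} \times (\{*\} \cup \mathbb{N}) \times \mathbb{N}$; a labelled clause $\langle (b,k,l) \rangle C$ is a pair of a label and a standard clause. For $K \in \mathbb{N}$, $L \in \mathbb{N}^+$, the set $R_{(K,L)}(b,k,l)$ consists of all $t \in \mathbb{N}$ such that (1) if $b \neq *$ then $t = 0$; (2) if $k \neq *$ then $t + k = K + sL$ for some $s \in \mathbb{N}$; (3) $L$ divides $l$. For a set $N$ of labelled clauses, $N_{(K,L)} = \{C^{(t)} : \langle (b,k,l)\rangle C \in N,\ t \in R_{(K,L)}(b,k,l)\}$; $N$ is $(K,L)$-satisfiable if some valuation $W^*: \Sigma^* \to \{0,1\}$ propositionally satisfies every clause of $N_{(K,L)}$, and $N$ is satisfiable if it is $(K,L)$-satisfiable for some $K \in \mathbb{N}$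 and $L \in \mathbb{N}^+$. -}

module Defs where

open import Data.Nat using (ℕ; zero; suc; _+_; _*_; _≤_)
open import Data.Nat.Divisibility using (_∣_)
open import Data.Fin using (Fin)
open import Data.Bool using (Bool; true; false)
open import Data.Maybe using (Maybe; just; nothing)
open import Data.List using (List; map; filterᵇ)
open import Data.List.Relation.Unary.Any using (Any)
open import Data.List.Membership.Propositional using (_∈_)
open import Data.Product using (Σ; ∃; _×_; _,_)
open import Data.Unit using (⊤)
open import Relation.Binary.PropositionalEquality using (_≡_)

-- Propositional variables of Σ* over Σ = Fin n: p^(i) is the pair (p , i).
record Var (n : ℕ) : Set where
  constructor var
  field
    sym : Fin n
    idx : ℕ
open Var public

record Literal (n : ℕ) : Set where
  constructor lit
  field
    pos : Bool
    lvar : Var n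
open Literal public

Clause : ℕ → Set
Clause n = List (Literal n)

shiftLit : ∀ {n} → ℕ → Literal n → Literal n
shiftLit t (lit s (var p i)) = lit s (var p (i + t))

shift : ∀ {n} → ℕ → Clause n → Clause n
shift t C = map (shiftLit t) C

-- Labels (b,k,l): b ∈ {*,0}, k ∈ {*} ∪ ℕ (nothing = *), l ∈ ℕ.
data BLabel : Set where
  bstar : BLabel
  bzero : BLabel

record Label : Set where
  constructor label
  field
    b : BLabel
    k : Maybe ℕ
    l : ℕ
open Label public

record LClause (n : ℕ) : Set where
  constructor ⟨_⟩_
  field
    lab : Label
    cl  : Clause n
open LClause public

CondB : BLabel → ℕ → Set
CondB bstar t = ⊤
CondB bzero t = t ≡ 0

CondK : ℕ → ℕ → Maybe ℕ → ℕ → Set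
CondK K L nothing  t = ⊤
CondK K L (just k) t = ∃ λ (s : ℕ) → t + k ≡ K + s * L

InR : ℕ → ℕ → Label → ℕ → Set
InR K L (label b k l) t = CondB b t × CondK K L k t × (L ∣ l)

LitSat : ∀ {n} → (Var n → Bool) → Literal n → Set
LitSat W (lit s v) = W v ≡ s

ClauseSat : ∀ {n} → (Var n → Bool) → Clause n → Set
ClauseSat W C = Any (LitSat W) C

KLSatisfiable : ∀ {n} → ℕ → ℕ → List (LClause n) → Set
KLSatisfiable {n} K L N =
  Σ (Var n → Bool) λ W →
    ∀ (c : LClause n) → c ∈ N → ∀ (t : ℕ) → InR K L (lab c) t → ClauseSat W (shift t (cl c))

Satisfiable : ∀ {n} → List (LClause n) → Set
Satisfiable N = Σ ℕ λ K → Σ ℕ λ L → (1 ≤ L) × KLSatisfiable K L N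

keep : ∀ {n} → LClause n → Bool
keep (⟨ label bstar k        zero ⟩ C) = true
keep (⟨ label bzero nothing  zero ⟩ C) = true
keep (⟨ label bzero (just _) zero ⟩ C) = false
keep (⟨ label _     _     (suc _) ⟩ C) = false

Nminus : ∀ {n} → List (LClause n) → List (LClause n)
Nminus N = filterᵇ keep N

-- A clause removed from N has a label (b,k,l) with l ≠ 0, or with b = 0 and k ∈ ℕ. If M > l
-- then M ∤ l, and if K' ≥ M > k then 0 + k = K' + sM is impossible; so for a period M larger
-- than every number in the labels of N, and offset K' ≥ M, removed clauses have no instances.
-- Taking M = mL and K' = K + mL only shrinks the instance sets of the remaining clauses, so a
-- (K,L)-model of N⁻ is a (K + mL, mL)-model of N. The converse holds because N⁻ ⊆ N.
module Submission where

open import Defs hiding (sym)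
open import Data.Nat using (ℕ; zero; suc; _+_; _*_; _≤_; _<_; s≤s; >-nonZero)
open import Data.Nat.Properties using (≤-trans; ≤-totalOrder; m≤m+n; m≤n+m; m≤m*n; <⇒≱; module ≤-Reasoning)
open import Data.Nat.Divisibility using (∣-trans; n∣m*n; ∣⇒≤)
open import Data.Nat.Tactic.RingSolver using (solve-∀)
open import Data.Bool using (true; false; T; T?)
open import Data.Maybe using (fromMaybe; just; nothing)
open import Data.List using (List; map)
open import Data.List.Extrema ≤-totalOrder using (max; xs≤max)
open import Data.List.Relation.Unary.All using (lookup)
open import Data.List.Relation.Unary.All.Properties using (map⁻)
open import Data.List.Membership.Propositional using (_∈_)
open import Data.List.Membership.Propositional.Properties using (∈-filter⁺)
open import Data.List.Relation.Binary.Subset.Propositional using (_⊆_)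
open import Data.List.Relation.Binary.Subset.Propositional.Properties using (filter-⊆)
open import Data.Product using (_×_; _,_)
open import Data.Unit using (tt)
open import Data.Empty using (⊥-elim)
open import Relation.Nullary using (¬_)
open import Relation.Binary.PropositionalEquality using (_≡_; refl; sym; trans; subst)

private
  variable
    n K L m t : ℕ

KLSatisfiable-⊆ : {N M : List (LClause n)} → N ⊆ M → KLSatisfiable K L M → KLSatisfiable K L N
KLSatisfiable-⊆ N⊆M (W , W⊨M) = W , λ c c∈N → W⊨M c (N⊆M c∈N)

Nminus-⊆ : (N : List (LClause n)) → Nminus N ⊆ N
Nminus-⊆ N = filter-⊆ (λ c → T? (keep c)) N

∈-Nminus : {N : List (LClause n)} {c : LClause n} → c ∈ N → keep c ≡ true → c ∈ Nminus N
∈-Nminus c∈N kept = ∈-filter⁺ (λ c → T? (keep c)) c∈N (subst T (sym kept) tt)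

InR-coarsen : (a : Label) → InR (K + m * L) (m * L) a t → InR K L a t
InR-coarsen {m = m} (label b nothing  l) (t∈B , tt , mL∣l) = t∈B , tt , ∣-trans (n∣m*n m) mL∣l
InR-coarsen {K} {m} {L} (label b (just k) l) (t∈B , (s , t+k≡) , mL∣l) =
  t∈B , (m + s * m , trans t+k≡ (regroup K m L s)) , ∣-trans (n∣m*n m) mL∣l
  where
  regroup : ∀ K m L s → K + m * L + s * (m * L) ≡ K + (m + s * m) * L
  regroup = solve-∀

-- The value chosen for k = * is irrelevant: only labels with k ∈ ℕ are ever bounded through it.
labelSize : Label → ℕ
labelSize (label _ k l) = fromMaybe 0 k + l

InR-empty-if-dropped : (c : LClause n) → keep c ≡ false → labelSize (lab c) < m →
                       ¬ InR (K + m) m (lab c) t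
InR-empty-if-dropped (⟨ label bstar k        zero    ⟩ C) ()
InR-empty-if-dropped (⟨ label bzero nothing  zero    ⟩ C) ()
InR-empty-if-dropped {m = m} {K = K} (⟨ label bzero (just k) zero ⟩ C) _ size<m (refl , (s , k≡) , _) =
  <⇒≱ k<m m≤k
  where
  k<m : k < m
  k<m = ≤-trans (s≤s (m≤m+n k 0)) size<m
  m≤k : m ≤ k
  m≤k = begin
    m             ≤⟨ m≤n+m m K ⟩
    K + m         ≤⟨ m≤m+n (K + m) (s * m) ⟩
    K + m + s * m ≡⟨ sym k≡ ⟩
    k             ∎
    where open ≤-Reasoning
InR-empty-if-dropped {m = m} (⟨ label _ k (suc j) ⟩ C) _ size<m (_ , _ , m∣l) =
  <⇒≱ (≤-trans (s≤s (m≤n+m (suc j) (fromMaybe 0 k))) size<m) (∣⇒≤ m∣l)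

labelBound : List (LClause n) → ℕ
labelBound N = max 0 (map (λ c → labelSize (lab c)) N)

labelSize≤labelBound : {N : List (LClause n)} {c : LClause n} → c ∈ N →
                       labelSize (lab c) ≤ labelBound N
labelSize≤labelBound {N = N} = lookup (map⁻ (xs≤max 0 (map (λ c → labelSize (lab c)) N)))

KLSatisfiable-Nminus⇒KLSatisfiable : (N : List (LClause n)) → 1 ≤ L →
  KLSatisfiable K L (Nminus N) →
  KLSatisfiable (K + suc (labelBound N) * L) (suc (labelBound N) * L) N
KLSatisfiable-Nminus⇒KLSatisfiable {n = n} {L = L} {K = K} N 1≤L (W , W⊨N⁻) = W , W⊨N
  where
  M = suc (labelBound N) * L

  size<M : {c : LClause n} → c ∈ N → labelSize (lab c) < M
  size<M c∈N = ≤-trans (s≤s (labelSize≤labelBound c∈N)) (m≤m*n (suc (labelBound N)) L {{>-nonZero 1≤L}})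

  W⊨N : (c : LClause n) → c ∈ N → ∀ t → InR (K + M) M (lab c) t → ClauseSat W (shift t (cl c))
  W⊨N c c∈N t t∈R with keep c in kept
  ... | true  = W⊨N⁻ c (∈-Nminus c∈N kept) t (InR-coarsen {m = suc (labelBound N)} (lab c) t∈R)
  ... | false = ⊥-elim (InR-empty-if-dropped {K = K} c kept (size<M c∈N) t∈R)

theorem2 : (n : ℕ) (N : List (LClause n)) →
    (Satisfiable (Nminus N) → Satisfiable N) × (Satisfiable N → Satisfiable (Nminus N))
theorem2 n N = to , from
  where
  to : Satisfiable (Nminus N) → Satisfiable N
  to (K , L , 1≤L , sat) =
    _ , _ , ≤-trans 1≤L (m≤m+n L _) , KLSatisfiable-Nminus⇒KLSatisfiable N 1≤L sat
  from : Satisfiable N → Satisfiable (Nminus N)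
  from (K , L , 1≤L , sat) = K , L , 1≤L , KLSatisfiable-⊆ (Nminus-⊆ N) sat
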